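{- Any online algorithm with advice for multi-coloring hexagonal graphs whose strict competitive ratio is strictly smaller than $\frac{3}{2}$ has advice complexity at least $\lfloor\frac{n-1}{3}\rfloor$, where $n$ is the number of requests.
   Context: A hexagonal graph is a graph obtained by placing at most one node in each cell of a hexagonal grid and adding an edge between every pair of nodes in neighboring cells. Online multi-coloring: the graph is known in advance; requests arrive one at a time, each naming a node $v$, and must immediately and irrevocably receive a color (positive integer) different from every color previously assigned to $v$ or any neighbor of $v$. $A(I)$ is the number of colors used and $\mathrm{Opt}(I)$ the minimum number an offline algorithm needs. Advice model: an all-powerful oracle knowing $I$ writes an infinite binary advice tape; advice complexity is the maximum index of a bit read. The strict competitive ratio of $A$ is the infimum of all $c$ such that $A(I)\le c\cdot\mathrm{Opt}(I)$ for all $I$. -}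

module Defs where

open import Data.Nat using (ℕ; zero; suc; _+_; _*_; _<_; _≤_)
import Data.Nat as ℕ
open import Data.Integer using (ℤ; +_; -[1+_]) renaming (_+_ to _+ℤ_)
open import Data.Bool using (Bool)
open import Data.Product using (_×_; _,_; Σ; ∃)
open import Data.List using (List; []; _∷_; length; deduplicate; _++_; [_])
open import Data.List.Membership.Propositional using (_∈_)
open import Data.List.Relation.Unary.All using (All)
open import Data.Fin using (Fin)
open import Relation.Binary.PropositionalEquality using (_≡_; _≢_)
open import Data.Sum using (_⊎_)
open import Data.Maybe using (Maybe; just; nothing)
open import Relation.Nullary using (¬_)

at : {A : Set} → List A → ℕ → Maybe A
at [] i = nothing
at (x ∷ xs) zero = just x
at (x ∷ xs) (suc i) = at xs i

-- Cells of the hexagonal grid, in axial coordinates (q , r).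
Cell : Set
Cell = ℤ × ℤ

neighbours : Cell → List Cell
neighbours (q , r) =
  (q +ℤ + 1 , r) ∷ (q +ℤ -[1+ 0 ] , r) ∷
  (q , r +ℤ + 1) ∷ (q , r +ℤ -[1+ 0 ]) ∷
  (q +ℤ + 1 , r +ℤ -[1+ 0 ]) ∷ (q +ℤ -[1+ 0 ] , r +ℤ + 1) ∷ []

Adj : Cell → Cell → Set
Adj a b = b ∈ neighbours a

-- An instance: a hexagonal graph (given by its finite set of occupied cells,
-- edges being all pairs of neighbouring occupied cells) and a request sequence
-- of nodes of that graph.
record Instance : Set where
  constructor mkInstance
  field
    nodes    : List Cell
    requests : List Cell
    reqsIn   : All (_∈ nodes) requests
open Instance public

size : Instance → ℕ
size I = length (requests I)

Tape : Set
Tape = ℕ → Bool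

-- Online algorithm with advice: given the advice tape, the graph (known in
-- advance), the requests seen so far and the current request, it outputs a
-- colour.  (Its own previous colours are a function of these data.)
Algorithm : Set
Algorithm = Tape → List Cell → List Cell → Cell → ℕ

runFrom : Algorithm → Tape → List Cell → List Cell → List Cell → List ℕ
runFrom A τ G past [] = []
runFrom A τ G past (v ∷ vs) = A τ G past v ∷ runFrom A τ G (past ++ [ v ]) vs

run : Algorithm → Tape → Instance → List ℕ
run A τ I = runFrom A τ (nodes I) [] (requests I)

ValidColouring : {C : Set} → List Cell → List C → Set
ValidColouring {C} reqs cols =
  Σ (length cols ≡ length reqs) λ _ →
  ∀ (i j : ℕ) (v w : Cell) (c d : C) → i < j →
    at reqs i ≡ just v →
    at reqs j ≡ just w →
    at cols i ≡ just c →
    at cols j ≡ just d →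
    (v ≡ w ⊎ Adj v w) → c ≢ d

coloursUsed : List ℕ → ℕ
coloursUsed cs = length (deduplicate ℕ._≟_ cs)

Colourable : Instance → ℕ → Set
Colourable I k = Σ (List (Fin k)) λ cols → ValidColouring (requests I) cols

IsOpt : Instance → ℕ → Set
IsOpt I k = Colourable I k × (∀ j → Colourable I j → k ≤ j)

-- On all instances with n requests, the algorithm with the oracle's advice
-- reads (at most) the first k bits of the tape, i.e. its whole run is
-- determined by those bits (advice complexity on length n is at most k).
ReadsAtMost : Algorithm → (Instance → Tape) → ℕ → ℕ → Set
ReadsAtMost A Φ n k =
  ∀ (I : Instance) → size I ≡ n →
  ∀ (τ : Tape) → (∀ i → i < k → τ i ≡ Φ I i) →
  run A τ I ≡ run A (Φ I) I

module Submission where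

-- The adversary builds a chain of reference nodes cell (2 + 2j) 2, joined by
-- blocks of three requests.  Block j first requests the next reference node;
-- its other two cells are chosen by a bit: a path from the old to the new
-- reference (punishing an algorithm that gave both references the same
-- colour) or a common neighbour of both (punishing one that did not).  A wrong
-- guess forces a third colour online, while every chain is 2-colourable
-- offline and needs two colours, so Opt = 2.  The algorithm's guess at block j
-- depends only on the earlier blocks, so a halving argument over the 2 ^ k
-- advice strings yields k + 1 blocks punishing every advice string somewhere.

open import Defs
open import Data.Nat using (ℕ; zero; suc; _+_; _*_; _^_; _≤_; _<_; _∸_; _/_; _≤′_; ≤′-refl; ≤′-step; z≤n; s≤s; _≟_; _≡ᵇ_; _<?_)
open import Data.Nat.Properties using (≤-refl; ≤-trans; n≤1+n; n<1+n; +-suc; +-comm; +-identityʳ; 1+n≰n; m≤n⇒m≤1+n; m≤m+n; m≤n+m; <⇒≤; +-mono-≤; +-cancelˡ-≡; +-monoʳ-<; +-cancelˡ-<; +-monoˡ-≤; ≤-<-trans; ≮⇒≥; ≡ᵇ⇒≡; ≡⇒≡ᵇ; ≤⇒≤′; ^-monoʳ-<; <-irrefl; <-≤-trans; *-comm; *-monoʳ-≤; *-monoˡ-≤; m+[n∸m]≡n; module ≤-Reasoning)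
open import Data.Nat.DivMod using (m/n*n≤m)
open import Data.Integer using (+_; -[1+_]) renaming (_+_ to _+ℤ_)
open import Data.Integer.Properties using (+-injective)
open import Data.Bool using (Bool; true; false; not; T)
import Data.Bool.Properties as Bool
open import Data.Unit using (tt)
open import Data.Fin using (Fin; zero; suc)
open import Data.Product using (_×_; _,_; proj₁; proj₂; Σ)
open import Data.Product.Properties using (,-injectiveˡ; ,-injectiveʳ)
open import Data.Sum using (_⊎_; inj₁; inj₂)
open import Data.Empty using (⊥; ⊥-elim)
open import Data.Maybe using (Maybe; just; nothing; fromMaybe)
open import Data.List using (List; []; _∷_; _++_; [_]; map; zip; length; deduplicate; filter; applyUpTo)
open import Data.List.Properties using (map-++; length-++; length-map; ++-assoc; ++-identityʳ)
open import Data.List.Membership.Propositional using (_∈_)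
open import Data.List.Membership.Propositional.Properties using (∈-++⁺ˡ; ∈-++⁺ʳ; ∈-map⁺; ∈-deduplicate⁺; ∈-filter⁺)
open import Data.List.Relation.Unary.Any using (here; there)
open import Data.List.Relation.Unary.All as All using (All; []; _∷_)
import Data.List.Relation.Unary.All.Properties as All
open import Data.List.Relation.Unary.AllPairs using (AllPairs; []; _∷_)
import Data.List.Relation.Unary.AllPairs.Properties as AllPairs
open import Relation.Binary.PropositionalEquality using (_≡_; _≢_; refl; sym; trans; cong; cong₂; subst; subst₂; module ≡-Reasoning)
open import Relation.Nullary using (¬_; yes; no)
open import Function using (_∘_)

cell : ℕ → ℕ → Cell
cell a b = (+ a , + b)

Conflict : Cell → Cell → Set
Conflict v w = v ≡ w ⊎ Adj v w

+a+1 : ∀ a → + a +ℤ + 1 ≡ + suc a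
+a+1 a = cong +_ (+-comm a 1)

adj-east : ∀ a b → Adj (cell a b) (cell (suc a) b)
adj-east a b = here (cong (_, + b) (sym (+a+1 a)))

adj-west : ∀ a b → Adj (cell (suc a) b) (cell a b)
adj-west a b = there (here refl)

adj-north : ∀ a b → Adj (cell a b) (cell a (suc b))
adj-north a b = there (there (here (cong (+ a ,_) (sym (+a+1 b)))))

adj-south : ∀ a b → Adj (cell a (suc b)) (cell a b)
adj-south a b = there (there (there (here refl)))

adj-southeast : ∀ a b → Adj (cell a (suc b)) (cell (suc a) b)
adj-southeast a b = there (there (there (there (here (cong (_, + b) (sym (+a+1 a)))))))

adj-northwest : ∀ a b → Adj (cell (suc a) b) (cell a (suc b))
adj-northwest a b = there (there (there (there (there (here (cong (+ a ,_) (sym (+a+1 b))))))))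

data Move : ℕ → ℕ → ℕ → ℕ → Set where
  stay      : ∀ {a b} → Move a b a b
  east      : ∀ {a b} → Move a b (suc a) b
  west      : ∀ {a b} → Move (suc a) b a b
  north     : ∀ {a b} → Move a b a (suc b)
  south     : ∀ {a b} → Move a (suc b) a b
  southeast : ∀ {a b} → Move a (suc b) (suc a) b
  northwest : ∀ {a b} → Move (suc a) b a (suc b)

minus-one : ∀ a {c} → + c ≡ + a +ℤ -[1+ 0 ] → a ≡ suc c
minus-one zero ()
minus-one (suc a) eq = cong suc (sym (+-injective eq))

plus-one : ∀ a {c} → + c ≡ + a +ℤ + 1 → c ≡ suc a
plus-one a eq = +-injective (trans eq (+a+1 a))

conflict⇒move : ∀ {a b c d} → Conflict (cell a b) (cell c d) → Move a b c d
conflict⇒move {a} {b} (inj₁ eq) with +-injective (,-injectiveˡ eq) | +-injective (,-injectiveʳ eq)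
... | refl | refl = stay
conflict⇒move {a} {b} (inj₂ (here eq)) with plus-one a (,-injectiveˡ eq) | +-injective (,-injectiveʳ eq)
... | refl | refl = east
conflict⇒move {a} {b} (inj₂ (there (here eq))) with minus-one a (,-injectiveˡ eq) | +-injective (,-injectiveʳ eq)
... | refl | refl = west
conflict⇒move {a} {b} (inj₂ (there (there (here eq)))) with +-injective (,-injectiveˡ eq) | plus-one b (,-injectiveʳ eq)
... | refl | refl = north
conflict⇒move {a} {b} (inj₂ (there (there (there (here eq))))) with +-injective (,-injectiveˡ eq) | minus-one b (,-injectiveʳ eq)
... | refl | refl = south
conflict⇒move {a} {b} (inj₂ (there (there (there (there (here eq)))))) with plus-one a (,-injectiveˡ eq) | minus-one b (,-injectiveʳ eq)
... | refl | refl = southeast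
conflict⇒move {a} {b} (inj₂ (there (there (there (there (there (here eq))))))) with minus-one a (,-injectiveˡ eq) | plus-one b (,-injectiveʳ eq)
... | refl | refl = northwest

Close : ℕ → ℕ → Set
Close x y = x ≤ suc y × y ≤ suc x

close-refl : ∀ x → Close x x
close-refl x = n≤1+n x , n≤1+n x

close-suc : ∀ x → Close x (suc x)
close-suc x = ≤-trans (n≤1+n x) (n≤1+n (suc x)) , ≤-refl

close-pred : ∀ x → Close (suc x) x
close-pred x = ≤-refl , ≤-trans (n≤1+n x) (n≤1+n (suc x))

-- A move changes each of the three hexagonal coordinates a, b and b + a by
-- at most one.
record Near (a b c d : ℕ) : Set where
  field
    near-a : Close a c
    near-b : Close b d
    near-sum : Close (b + a) (d + c)

move⇒near : ∀ {a b c d} → Move a b c d → Near a b c d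
move⇒near (stay {a} {b}) = record { near-a = close-refl a ; near-b = close-refl b ; near-sum = close-refl (b + a) }
move⇒near (east {a} {b}) = record { near-a = close-suc a ; near-b = close-refl b
  ; near-sum = subst (Close (b + a)) (sym (+-suc b a)) (close-suc (b + a)) }
move⇒near (west {a} {b}) = record { near-a = close-pred a ; near-b = close-refl b
  ; near-sum = subst (λ z → Close z (b + a)) (sym (+-suc b a)) (close-pred (b + a)) }
move⇒near (north {a} {b}) = record { near-a = close-refl a ; near-b = close-suc b ; near-sum = close-suc (b + a) }
move⇒near (south {a} {b}) = record { near-a = close-refl a ; near-b = close-pred b ; near-sum = close-pred (b + a) }
move⇒near (southeast {a} {b}) = record { near-a = close-suc a ; near-b = close-pred b
  ; near-sum = subst (Close (suc (b + a))) (sym (+-suc b a)) (close-refl (suc (b + a))) }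
move⇒near (northwest {a} {b}) = record { near-a = close-pred a ; near-b = close-suc b
  ; near-sum = subst (λ z → Close z (suc (b + a))) (sym (+-suc b a)) (close-refl (suc (b + a))) }

Apart : ℕ → ℕ → Set
Apart x y = 2 + x ≤ y ⊎ 2 + y ≤ x

apart⇒¬close : ∀ {x y} → Apart x y → ¬ Close x y
apart⇒¬close (inj₁ p) (_ , q) = 1+n≰n (≤-trans p q)
apart⇒¬close (inj₂ p) (q , _) = 1+n≰n (≤-trans p q)

Far : ℕ → ℕ → ℕ → ℕ → Set
Far a b c d = Apart a c ⊎ Apart b d ⊎ Apart (b + a) (d + c)

far⇒no-conflict : ∀ {a b c d} → Far a b c d → ¬ Conflict (cell a b) (cell c d)
far⇒no-conflict separated conflict with move⇒near (conflict⇒move conflict) | separated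
... | near | inj₁ apart = apart⇒¬close apart (Near.near-a near)
... | near | inj₂ (inj₁ apart) = apart⇒¬close apart (Near.near-b near)
... | near | inj₂ (inj₂ apart) = apart⇒¬close apart (Near.near-sum near)

Compatible : {C : Set} → Cell × C → Cell × C → Set
Compatible (v , c) (w , d) = Conflict v w → c ≢ d

differ : ∀ {C : Set} {v w} {c d : C} → c ≢ d → Compatible (v , c) (w , d)
differ c≢d _ = c≢d

far : ∀ {C : Set} {a b c d} {x y : C} → Far a b c d → Compatible (cell a b , x) (cell c d , y)
far apart conflict _ = far⇒no-conflict apart conflict

left-of : ∀ {a b c d} → 2 + a ≤ c → Far a b c d
left-of h = inj₁ (inj₁ h)

right-of : ∀ {a b c d} → 2 + c ≤ a → Far a b c d
right-of h = inj₁ (inj₂ h)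

under : ∀ {a b c d} → 2 + b ≤ d → Far a b c d
under h = inj₂ (inj₁ (inj₁ h))

over : ∀ {a b c d} → 2 + d ≤ b → Far a b c d
over h = inj₂ (inj₁ (inj₂ h))

diagonal-under : ∀ {a b c d} → 2 + (b + a) ≤ d + c → Far a b c d
diagonal-under h = inj₂ (inj₂ (inj₁ h))

diagonal-over : ∀ {a b c d} → 2 + (d + c) ≤ b + a → Far a b c d
diagonal-over h = inj₂ (inj₂ (inj₂ h))

Col : Set
Col = Fin 2

other : Col → Col
other zero = suc zero
other (suc _) = zero

other-≢ : ∀ s → other s ≢ s
other-≢ zero ()
other-≢ (suc zero) ()

≢-other : ∀ s → s ≢ other s
≢-other s eq = other-≢ s (sym eq)

-- Consecutive blocks of the chain alternate between the two sides of row 2.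
data Side : Set where
  below above : Side

opposite : Side → Side
opposite below = above
opposite above = below

-- The block following a reference node at cell Q 2.  Its first request is the
-- next reference node, cell (2 + Q) 2.  If the bit is true, the next two
-- requests form a path from a neighbour of the old reference to a neighbour
-- of the new one; if it is false, they are a common neighbour of both
-- references and an isolated cell on row 10 (keeping every block of length 3).
blockCells : Bool → Side → ℕ → List Cell
blockCells true below Q = cell (2 + Q) 2 ∷ cell (1 + Q) 1 ∷ cell (2 + Q) 1 ∷ []
blockCells true above Q = cell (2 + Q) 2 ∷ cell Q 3 ∷ cell (1 + Q) 3 ∷ []
blockCells false _ Q = cell (2 + Q) 2 ∷ cell (1 + Q) 2 ∷ cell (1 + Q) 10 ∷ []

blockColours : Bool → Col → List Col
blockColours true s = other s ∷ other s ∷ s ∷ []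
blockColours false s = s ∷ other s ∷ s ∷ []

nextColour : Bool → Col → Col
nextColour true s = other s
nextColour false s = s

colouredBlock : Bool → Side → ℕ → Col → List (Cell × Col)
colouredBlock β sd Q s = zip (blockCells β sd Q) (blockColours β s)

cells-colouredBlock : ∀ β sd Q s → map proj₁ (colouredBlock β sd Q s) ≡ blockCells β sd Q
cells-colouredBlock true below Q s = refl
cells-colouredBlock true above Q s = refl
cells-colouredBlock false sd Q s = refl

block-compatible : ∀ β sd Q s → AllPairs Compatible (colouredBlock β sd Q s)
block-compatible true below Q s =
  (far (diagonal-over ≤-refl) ∷ differ (other-≢ s) ∷ []) ∷ (differ (other-≢ s) ∷ []) ∷ [] ∷ []
block-compatible true above Q s =
  (far (right-of ≤-refl) ∷ differ (other-≢ s) ∷ []) ∷ (differ (other-≢ s) ∷ []) ∷ [] ∷ []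
block-compatible false sd Q s =
  (differ (≢-other s) ∷ far (under (m≤m+n 4 6)) ∷ []) ∷ (differ (other-≢ s) ∷ []) ∷ [] ∷ []

-- The cells requested before a block, other than its reference node, lie
-- "behind" it: far from every cell the block may contain.  Cells below row 3
-- are to the left of the block if it lies below row 2, and on the lower-left
-- side of the anti-diagonal through it if it lies above; the isolated cells
-- of row 10 are to the left of it.
data Behind : Side → ℕ → Cell → Set where
  low-below : ∀ {Q a b} → b ≤ 3 → a < Q → Behind below Q (cell a b)
  low-above : ∀ {Q a b} → b ≤ 3 → b + a ≤ suc Q → Behind above Q (cell a b)
  parked    : ∀ {sd Q a} → a < Q → Behind sd Q (cell a 10)

behind-compatible : ∀ β sd Q s {v c} → Behind sd Q v → All (Compatible (v , c)) (colouredBlock β sd Q s)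
behind-compatible true .below Q s (low-below _ a<Q) = far (left-of (m≤n⇒m≤1+n (s≤s a<Q))) ∷ far (left-of (s≤s a<Q)) ∷ far (left-of (m≤n⇒m≤1+n (s≤s a<Q))) ∷ []
behind-compatible false .below Q s (low-below _ a<Q) = far (left-of (m≤n⇒m≤1+n (s≤s a<Q))) ∷ far (left-of (s≤s a<Q)) ∷ far (left-of (s≤s a<Q)) ∷ []
behind-compatible true .above Q s (low-above _ h) = far (diagonal-under (m≤n⇒m≤1+n (s≤s (s≤s h)))) ∷ far (diagonal-under (s≤s (s≤s h))) ∷ far (diagonal-under (m≤n⇒m≤1+n (s≤s (s≤s h)))) ∷ []
behind-compatible false .above Q s (low-above b≤3 h) = far (diagonal-under (m≤n⇒m≤1+n (s≤s (s≤s h)))) ∷ far (diagonal-under (s≤s (s≤s h))) ∷ far (under (≤-trans (s≤s (s≤s b≤3)) (m≤m+n 5 5))) ∷ []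
behind-compatible true below Q s (parked a<Q) = far (left-of (m≤n⇒m≤1+n (s≤s a<Q))) ∷ far (left-of (s≤s a<Q)) ∷ far (left-of (m≤n⇒m≤1+n (s≤s a<Q))) ∷ []
behind-compatible true above Q s (parked _) = far (over (m≤m+n 4 6)) ∷ far (over (m≤m+n 5 5)) ∷ far (over (m≤m+n 5 5)) ∷ []
behind-compatible false sd Q s (parked a<Q) = far (left-of (m≤n⇒m≤1+n (s≤s a<Q))) ∷ far (left-of (s≤s a<Q)) ∷ far (left-of (s≤s a<Q)) ∷ []

reference-compatible : ∀ β sd Q s → All (Compatible (cell Q 2 , s)) (colouredBlock β sd Q s)
reference-compatible true below Q s = far (left-of ≤-refl) ∷ differ (≢-other s) ∷ far (left-of ≤-refl) ∷ []
reference-compatible true above Q s = far (left-of ≤-refl) ∷ differ (≢-other s) ∷ far (diagonal-under ≤-refl) ∷ []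
reference-compatible false sd Q s = far (left-of ≤-refl) ∷ differ (≢-other s) ∷ far (under (m≤m+n 4 6)) ∷ []

behind-next : ∀ {sd Q v} → Behind sd Q v → Behind (opposite sd) (2 + Q) v
behind-next (low-below b≤3 a<Q) = low-above b≤3 (+-mono-≤ b≤3 (<⇒≤ a<Q))
behind-next (low-above {a = a} {b} b≤3 h) = low-below b≤3 (s≤s (≤-trans (m≤n+m a b) h))
behind-next {Q = Q} (parked a<Q) = parked (≤-trans a<Q (m≤n+m Q 2))

Settled : Side → ℕ → Col → Cell × Col → Set
Settled sd Q s p = p ≡ (cell Q 2 , s) ⊎ Behind sd Q (proj₁ p)

settled-compatible : ∀ β sd Q s {p} → Settled sd Q s p → All (Compatible p) (colouredBlock β sd Q s)
settled-compatible β sd Q s (inj₁ refl) = reference-compatible β sd Q s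
settled-compatible β sd Q s (inj₂ behind) = behind-compatible β sd Q s behind

settled-next : ∀ β sd Q s {p} → Settled sd Q s p → Settled (opposite sd) (2 + Q) (nextColour β s) p
settled-next β below Q s (inj₁ refl) = inj₂ (low-above (s≤s (s≤s z≤n)) (n≤1+n (2 + Q)))
settled-next β above Q s (inj₁ refl) = inj₂ (low-below (s≤s (s≤s z≤n)) (n≤1+n (suc Q)))
settled-next β sd Q s (inj₂ behind) = inj₂ (behind-next behind)

block-settled : ∀ β sd Q s → All (Settled (opposite sd) (2 + Q) (nextColour β s)) (colouredBlock β sd Q s)
block-settled true below Q s =
  inj₁ refl ∷ inj₂ (low-above (s≤s z≤n) (n≤1+n (2 + Q))) ∷ inj₂ (low-above (s≤s z≤n) ≤-refl) ∷ []
block-settled true above Q s =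
  inj₁ refl ∷ inj₂ (low-below ≤-refl (n≤1+n (suc Q))) ∷ inj₂ (low-below ≤-refl ≤-refl) ∷ []
block-settled false below Q s =
  inj₁ refl ∷ inj₂ (low-above (s≤s (s≤s z≤n)) ≤-refl) ∷ inj₂ (parked ≤-refl) ∷ []
block-settled false above Q s =
  inj₁ refl ∷ inj₂ (low-below (s≤s (s≤s z≤n)) ≤-refl) ∷ inj₂ (parked ≤-refl) ∷ []

side : ℕ → Side
side zero = below
side (suc j) = opposite (side j)

column : ℕ → ℕ
column zero = 2
column (suc j) = 2 + column j

reference : ℕ → Cell
reference j = cell (column j) 2

chain : (ℕ → Bool) → ℕ → List Cell
chain f zero = reference 0 ∷ []
chain f (suc j) = chain f j ++ blockCells (f j) (side j) (column j)

referenceColour : (ℕ → Bool) → ℕ → Col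
referenceColour f zero = zero
referenceColour f (suc j) = nextColour (f j) (referenceColour f j)

colouredChain : (ℕ → Bool) → ℕ → List (Cell × Col)
colouredChain f zero = (reference 0 , zero) ∷ []
colouredChain f (suc j) = colouredChain f j ++ colouredBlock (f j) (side j) (column j) (referenceColour f j)

cells-colouredChain : ∀ f j → map proj₁ (colouredChain f j) ≡ chain f j
cells-colouredChain f zero = refl
cells-colouredChain f (suc j) = trans (map-++ proj₁ (colouredChain f j) _)
  (cong₂ _++_ (cells-colouredChain f j) (cells-colouredBlock (f j) (side j) (column j) (referenceColour f j)))

chain-compatible : ∀ f j →
  AllPairs Compatible (colouredChain f j) ×
  All (Settled (side j) (column j) (referenceColour f j)) (colouredChain f j)
chain-compatible f zero = ([] ∷ []) , (inj₁ refl ∷ [])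
chain-compatible f (suc j) with chain-compatible f j
... | proper , settled =
  AllPairs.++⁺ proper (block-compatible β sd Q s) (All.map (settled-compatible β sd Q s) settled) ,
  All.++⁺ (All.map (settled-next β sd Q s) settled) (block-settled β sd Q s)
  where
    β : Bool
    β = f j
    sd : Side
    sd = side j
    Q : ℕ
    Q = column j
    s : Col
    s = referenceColour f j

padding : ℕ → ℕ → List (Cell × Col)
padding zero a = []
padding (suc e) a = (cell a 20 , zero) ∷ padding e (2 + a)

data OnRow20From (a : ℕ) : Cell → Set where
  on-row-20 : ∀ {c} → a ≤ c → OnRow20From a (cell c 20)

padding-from : ∀ e a → All (λ p → OnRow20From a (proj₁ p)) (padding e a)
padding-from zero a = []
padding-from (suc e) a = on-row-20 ≤-refl ∷ All.map shift (padding-from e (2 + a))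
  where
    shift : ∀ {v} → OnRow20From (2 + a) v → OnRow20From a v
    shift (on-row-20 h) = on-row-20 (≤-trans (m≤n+m a 2) h)

padding-compatible : ∀ e a → AllPairs Compatible (padding e a)
padding-compatible zero a = []
padding-compatible (suc e) a = All.map later (padding-from e (2 + a)) ∷ padding-compatible e (2 + a)
  where
    later : ∀ {p} → OnRow20From (2 + a) (proj₁ p) → Compatible (cell a 20 , zero) p
    later (on-row-20 h) = far (left-of h)

data Low : Cell → Set where
  low : ∀ {a b} → b ≤ 10 → Low (cell a b)

settled-low : ∀ {sd Q s p} → Settled sd Q s p → Low (proj₁ p)
settled-low (inj₁ refl) = low (m≤m+n 2 8)
settled-low (inj₂ (low-below b≤3 _)) = low (≤-trans b≤3 (m≤m+n 3 7))
settled-low (inj₂ (low-above b≤3 _)) = low (≤-trans b≤3 (m≤m+n 3 7))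
settled-low (inj₂ (parked _)) = low ≤-refl

low-padding-compatible : ∀ e a {v c} → Low v → All (Compatible (v , c)) (padding e a)
low-padding-compatible e a {c = c} (low {a′} {b} b≤10) = All.map apart (padding-from e a)
  where
    apart : ∀ {p} → OnRow20From a (proj₁ p) → Compatible (cell a′ b , c) p
    apart (on-row-20 _) = far (under (≤-trans (s≤s (s≤s b≤10)) (m≤m+n 12 8)))

offlineColouring : (ℕ → Bool) → ℕ → ℕ → List (Cell × Col)
offlineColouring f m e = colouredChain f m ++ padding e 0

offline-compatible : ∀ f m e → AllPairs Compatible (offlineColouring f m e)
offline-compatible f m e with chain-compatible f m
... | proper , settled = AllPairs.++⁺ proper (padding-compatible e 0)
  (All.map (λ s → low-padding-compatible e 0 (settled-low s)) settled)

at-++ˡ : ∀ {X : Set} (xs ys : List X) {i v} → at xs i ≡ just v → at (xs ++ ys) i ≡ just v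
at-++ˡ (x ∷ xs) ys {zero} e = e
at-++ˡ (x ∷ xs) ys {suc i} e = at-++ˡ xs ys e

at-++ʳ : ∀ {X : Set} (xs ys : List X) t → at (xs ++ ys) (length xs + t) ≡ at ys t
at-++ʳ [] ys t = refl
at-++ʳ (x ∷ xs) ys t = at-++ʳ xs ys t

at-++ʳ-length : ∀ {X : Set} (xs ys : List X) {n} → length xs ≡ n → ∀ t → at (xs ++ ys) (n + t) ≡ at ys t
at-++ʳ-length xs ys refl t = at-++ʳ xs ys t

at⇒∈ : ∀ {X : Set} (xs : List X) {i v} → at xs i ≡ just v → v ∈ xs
at⇒∈ (x ∷ xs) {zero} refl = here refl
at⇒∈ (x ∷ xs) {suc i} e = there (at⇒∈ xs e)

at⇒< : ∀ {X : Set} (xs : List X) {i v} → at xs i ≡ just v → i < length xs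
at⇒< (x ∷ xs) {zero} e = s≤s z≤n
at⇒< (x ∷ xs) {suc i} e = s≤s (at⇒< xs e)

<⇒at : ∀ {X : Set} (xs : List X) {i} → i < length xs → Σ X λ v → at xs i ≡ just v
<⇒at (x ∷ xs) {zero} _ = x , refl
<⇒at (x ∷ xs) {suc i} (s≤s h) = <⇒at xs h

valid-prefix : ∀ {C : Set} (xs ys : List Cell) (cs ds : List C) → length cs ≡ length xs →
  ValidColouring (xs ++ ys) (cs ++ ds) → ValidColouring xs cs
valid-prefix xs ys cs ds len (_ , valid) = len , λ i j v w c d i<j vi wj ci dj →
  valid i j v w c d i<j (at-++ˡ xs ys vi) (at-++ˡ xs ys wj) (at-++ˡ cs ds ci) (at-++ˡ cs ds dj)

valid-suffix : ∀ {C : Set} (xs ys : List Cell) (cs ds : List C) → length cs ≡ length xs →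
  ValidColouring (xs ++ ys) (cs ++ ds) → ValidColouring ys ds
valid-suffix xs ys cs ds len (total , valid) = suffix-length , λ i j v w c d i<j vi wj ci dj →
  valid (n + i) (n + j) v w c d (+-monoʳ-< n i<j)
    (trans (at-++ʳ xs ys i) vi) (trans (at-++ʳ xs ys j) wj)
    (trans (at-++ʳ-length cs ds len i) ci) (trans (at-++ʳ-length cs ds len j) dj)
  where
    n : ℕ
    n = length xs
    suffix-length : length ds ≡ length ys
    suffix-length = +-cancelˡ-≡ n _ _ (begin
      n + length ds          ≡⟨ cong (_+ length ds) (sym len) ⟩
      length cs + length ds  ≡⟨ sym (length-++ cs) ⟩
      length (cs ++ ds)      ≡⟨ total ⟩
      length (xs ++ ys)      ≡⟨ length-++ xs ⟩
      n + length ys          ∎)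
      where open ≡-Reasoning

valid-across : ∀ {C : Set} (xs ys : List Cell) (cs ds : List C) → length cs ≡ length xs →
  ValidColouring (xs ++ ys) (cs ++ ds) →
  ∀ {p t v w c d} → at xs p ≡ just v → at cs p ≡ just c → at ys t ≡ just w → at ds t ≡ just d →
  Conflict v w → c ≢ d
valid-across xs ys cs ds len (_ , valid) {p} {t} vp cp wt dt =
  valid p (n + t) _ _ _ _ (≤-trans (at⇒< xs vp) (m≤m+n n t))
    (at-++ˡ xs ys vp) (trans (at-++ʳ xs ys t) wt) (at-++ˡ cs ds cp) (trans (at-++ʳ-length cs ds len t) dt)
  where
    n : ℕ
    n = length xs

compatible⇒valid : ∀ {C : Set} (xs : List (Cell × C)) → AllPairs Compatible xs →
  ValidColouring (map proj₁ xs) (map proj₂ xs)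
compatible⇒valid xs compatible = trans (length-map proj₂ xs) (sym (length-map proj₁ xs)) , valid xs compatible
  where
    lookup-pair : ∀ {C : Set} {P : Cell × C → Set} (xs : List (Cell × C)) {j w d} → All P xs →
      at (map proj₁ xs) j ≡ just w → at (map proj₂ xs) j ≡ just d → P (w , d)
    lookup-pair (_ ∷ xs) {zero} (px ∷ _) refl refl = px
    lookup-pair (_ ∷ xs) {suc j} (_ ∷ pxs) wj dj = lookup-pair xs pxs wj dj

    valid : ∀ {C : Set} (xs : List (Cell × C)) → AllPairs Compatible xs →
      ∀ i j v w c d → i < j → at (map proj₁ xs) i ≡ just v → at (map proj₁ xs) j ≡ just w →
      at (map proj₂ xs) i ≡ just c → at (map proj₂ xs) j ≡ just d → Conflict v w → c ≢ d
    valid (_ ∷ xs) (first ∷ _) zero (suc j) _ w _ d _ refl wj refl dj = lookup-pair xs first wj dj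
    valid (_ ∷ xs) (_ ∷ rest) (suc i) (suc j) v w c d (s≤s i<j) = valid xs rest i j v w c d i<j

record ThreeColours (cs : List ℕ) : Set where
  constructor three
  field
    {c₁ c₂ c₃} : ℕ
    c₁∈ : c₁ ∈ cs
    c₂∈ : c₂ ∈ cs
    c₃∈ : c₃ ∈ cs
    c₁≢c₂ : c₁ ≢ c₂
    c₂≢c₃ : c₂ ≢ c₃
    c₁≢c₃ : c₁ ≢ c₃

three-++ : ∀ cs ds → ThreeColours cs → ThreeColours (cs ++ ds)
three-++ cs ds (three c₁∈ c₂∈ c₃∈ c₁≢c₂ c₂≢c₃ c₁≢c₃) = three (∈-++⁺ˡ c₁∈) (∈-++⁺ˡ c₂∈) (∈-++⁺ˡ c₃∈) c₁≢c₂ c₂≢c₃ c₁≢c₃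

∈-tail : ∀ {a y : ℕ} {ys} → a ∈ y ∷ ys → a ≢ y → a ∈ ys
∈-tail (here a≡y) a≢y = ⊥-elim (a≢y a≡y)
∈-tail (there a∈ys) _ = a∈ys

one-member : ∀ {a : ℕ} {ys} → a ∈ ys → 1 ≤ length ys
one-member (here _) = s≤s z≤n
one-member (there _) = s≤s z≤n

two-members : ∀ {a b : ℕ} ys → a ∈ ys → b ∈ ys → a ≢ b → 2 ≤ length ys
two-members {a} {b} (y ∷ ys) a∈ b∈ a≢b with a ≟ y | b ≟ y
... | yes refl | _ = s≤s (one-member (∈-tail b∈ (a≢b ∘ sym)))
... | no a≢y | yes refl = s≤s (one-member (∈-tail a∈ a≢y))
... | no a≢y | no b≢y = ≤-trans (two-members ys (∈-tail a∈ a≢y) (∈-tail b∈ b≢y) a≢b) (n≤1+n _)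

three-members : ∀ {a b c : ℕ} ys → a ∈ ys → b ∈ ys → c ∈ ys → a ≢ b → b ≢ c → a ≢ c → 3 ≤ length ys
three-members {a} {b} {c} (y ∷ ys) a∈ b∈ c∈ a≢b b≢c a≢c with a ≟ y | b ≟ y | c ≟ y
... | yes refl | _ | _ = s≤s (two-members ys (∈-tail b∈ (a≢b ∘ sym)) (∈-tail c∈ (a≢c ∘ sym)) b≢c)
... | no a≢y | yes refl | _ = s≤s (two-members ys (∈-tail a∈ a≢y) (∈-tail c∈ (b≢c ∘ sym)) a≢c)
... | no a≢y | no b≢y | yes refl = s≤s (two-members ys (∈-tail a∈ a≢y) (∈-tail b∈ b≢y) a≢b)
... | no a≢y | no b≢y | no c≢y =
  ≤-trans (three-members ys (∈-tail a∈ a≢y) (∈-tail b∈ b≢y) (∈-tail c∈ c≢y) a≢b b≢c a≢c) (n≤1+n _)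

three⇒coloursUsed : ∀ cs → ThreeColours cs → 3 ≤ coloursUsed cs
three⇒coloursUsed cs (three c₁∈ c₂∈ c₃∈ c₁≢c₂ c₂≢c₃ c₁≢c₃) =
  three-members (deduplicate _≟_ cs) (∈-deduplicate⁺ _≟_ c₁∈) (∈-deduplicate⁺ _≟_ c₂∈) (∈-deduplicate⁺ _≟_ c₃∈)
    c₁≢c₂ c₂≢c₃ c₁≢c₃

record LastThreeDistinct (u x y : Cell) (cu cx cy : ℕ) : Set where
  field
    ux : Adj u x → cu ≢ cx
    xy : Adj x y → cx ≢ cy
    uy : Adj u y → cu ≢ cy

valid-last-three : ∀ (xs : List Cell) (cs : List ℕ) → length cs ≡ length xs → ∀ {u x y cu cx cy} →
  ValidColouring (xs ++ u ∷ x ∷ y ∷ []) (cs ++ cu ∷ cx ∷ cy ∷ []) → LastThreeDistinct u x y cu cx cy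
valid-last-three xs cs len valid with valid-suffix xs _ cs _ len valid
... | _ , last = record
  { ux = λ a → last 0 1 _ _ _ _ (s≤s z≤n) refl refl refl refl (inj₂ a)
  ; xy = λ a → last 1 2 _ _ _ _ (s≤s (s≤s z≤n)) refl refl refl refl (inj₂ a)
  ; uy = λ a → last 0 2 _ _ _ _ (s≤s z≤n) refl refl refl refl (inj₂ a)
  }

data BlockShape (r u : Cell) : Bool → List Cell → Set where
  path : ∀ {x y} → Adj r x → Adj x y → Adj u y → BlockShape r u true (u ∷ x ∷ y ∷ [])
  fork : ∀ {x z} → Adj r x → Adj u x → BlockShape r u false (u ∷ x ∷ z ∷ [])

block-shape : ∀ β sd Q → BlockShape (cell Q 2) (cell (2 + Q) 2) β (blockCells β sd Q)
block-shape true below Q = path (adj-southeast Q 1) (adj-east (suc Q) 1) (adj-south (2 + Q) 1)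
block-shape true above Q = path (adj-north Q 2) (adj-east Q 3) (adj-northwest (suc Q) 2)
block-shape false sd Q = fork (adj-east Q 2) (adj-west (suc Q) 2)

-- If u received the colour c of r, the path r – x – y – u forces colours c, cx, cy.
path-three : ∀ (xs : List Cell) (cs : List ℕ) → length cs ≡ length xs →
  ∀ {p r c u x y cu cx cy} → at xs p ≡ just r → at cs p ≡ just c →
  ValidColouring (xs ++ u ∷ x ∷ y ∷ []) (cs ++ cu ∷ cx ∷ cy ∷ []) →
  cu ≡ c → Adj r x → Adj x y → Adj u y → ThreeColours (cs ++ cu ∷ cx ∷ cy ∷ [])
path-three xs cs len rp cp valid refl rx xy uy =
  three (∈-++⁺ˡ (at⇒∈ cs cp)) (∈-++⁺ʳ cs (there (here refl))) (∈-++⁺ʳ cs (there (there (here refl))))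
    (valid-across xs _ cs _ len valid {t = 1} rp cp refl refl (inj₂ rx))
    (LastThreeDistinct.xy (valid-last-three xs cs len valid) xy)
    (LastThreeDistinct.uy (valid-last-three xs cs len valid) uy)

-- If u received a colour other than the colour c of r, their common
-- neighbour x forces colours c, cu, cx.
fork-three : ∀ (xs : List Cell) (cs : List ℕ) → length cs ≡ length xs →
  ∀ {p r c u x z cu cx cz} → at xs p ≡ just r → at cs p ≡ just c →
  ValidColouring (xs ++ u ∷ x ∷ z ∷ []) (cs ++ cu ∷ cx ∷ cz ∷ []) →
  cu ≢ c → Adj r x → Adj u x → ThreeColours (cs ++ cu ∷ cx ∷ cz ∷ [])
fork-three xs cs len rp cp valid cu≢c rx ux =
  three (∈-++⁺ˡ (at⇒∈ cs cp)) (∈-++⁺ʳ cs (here refl)) (∈-++⁺ʳ cs (there (here refl)))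
    (cu≢c ∘ sym)
    (LastThreeDistinct.ux (valid-last-three xs cs len valid) ux)
    (valid-across xs _ cs _ len valid {t = 1} rp cp refl refl (inj₂ rx))

sameColour : Maybe ℕ → ℕ → Bool
sameColour (just c) d = d ≡ᵇ c
sameColour nothing d = false

referenceIndex : ℕ → ℕ
referenceIndex zero = 0
referenceIndex (suc j) = suc (j * 3)

length-blockCells : ∀ β sd Q → length (blockCells β sd Q) ≡ 3
length-blockCells true below Q = refl
length-blockCells true above Q = refl
length-blockCells false sd Q = refl

length-chain : ∀ f j → length (chain f j) ≡ suc (j * 3)
length-chain f zero = refl
length-chain f (suc j) = begin
  length (chain f j ++ blockCells (f j) (side j) (column j))
    ≡⟨ length-++ (chain f j) ⟩
  length (chain f j) + length (blockCells (f j) (side j) (column j))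
    ≡⟨ cong₂ _+_ (length-chain f j) (length-blockCells (f j) (side j) (column j)) ⟩
  suc (j * 3) + 3
    ≡⟨ cong suc (+-comm (j * 3) 3) ⟩
  suc (suc j * 3) ∎
  where open ≡-Reasoning

shape-head : ∀ {r u β ys} → BlockShape r u β ys → at ys 0 ≡ just u
shape-head (path _ _ _) = refl
shape-head (fork _ _) = refl

reference-at : ∀ f j → at (chain f j) (referenceIndex j) ≡ just (reference j)
reference-at f zero = refl
reference-at f (suc j) = begin
  at (chain f j ++ block) (suc (j * 3))     ≡⟨ cong (at (chain f j ++ block)) index ⟩
  at (chain f j ++ block) (length (chain f j) + 0) ≡⟨ at-++ʳ (chain f j) block 0 ⟩
  at block 0                                ≡⟨ shape-head (block-shape (f j) (side j) (column j)) ⟩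
  just (reference (suc j))                  ∎
  where
    open ≡-Reasoning
    block : List Cell
    block = blockCells (f j) (side j) (column j)
    index : suc (j * 3) ≡ length (chain f j) + 0
    index = sym (trans (+-identityʳ _) (length-chain f j))

chain-agree : ∀ f g j → (∀ t → t < j → f t ≡ g t) → chain f j ≡ chain g j
chain-agree f g zero _ = refl
chain-agree f g (suc j) agree = cong₂ _++_
  (chain-agree f g j (λ t t<j → agree t (≤-trans t<j (n≤1+n j))))
  (cong (λ β → blockCells β (side j) (column j)) (agree j ≤-refl))

chain-prefix : ∀ f {i j} → i ≤′ j → Σ (List Cell) λ ys → chain f j ≡ chain f i ++ ys
chain-prefix f ≤′-refl = [] , sym (++-identityʳ _)
chain-prefix f {i} (≤′-step {j} i≤′j) with chain-prefix f i≤′j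
... | ys , grown = ys ++ blockCells (f j) (side j) (column j) ,
  trans (cong (_++ blockCells (f j) (side j) (column j)) grown) (++-assoc (chain f i) ys _)

module Serve (A : Algorithm) (G : List Cell) where

  serve : Tape → List Cell → List Cell → List ℕ
  serve τ = runFrom A τ G

  serve-length : ∀ τ past xs → length (serve τ past xs) ≡ length xs
  serve-length τ past [] = refl
  serve-length τ past (x ∷ xs) = cong suc (serve-length τ (past ++ [ x ]) xs)

  serve-++ : ∀ τ past xs ys → serve τ past (xs ++ ys) ≡ serve τ past xs ++ serve τ (past ++ xs) ys
  serve-++ τ past [] ys = cong (λ past′ → serve τ past′ ys) (sym (++-identityʳ past))
  serve-++ τ past (x ∷ xs) ys = cong (A τ G past x ∷_) (trans (serve-++ τ (past ++ [ x ]) xs ys)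
    (cong (λ past′ → serve τ (past ++ [ x ]) xs ++ serve τ past′ ys) (++-assoc past [ x ] xs)))

  Forces : Tape → List Cell → Set
  Forces τ xs = ValidColouring xs (serve τ [] xs) → ThreeColours (serve τ [] xs)

  forces-appended : ∀ τ xs ys →
    (ValidColouring (xs ++ ys) (serve τ [] xs ++ serve τ xs ys) → ThreeColours (serve τ [] xs ++ serve τ xs ys)) →
    Forces τ (xs ++ ys)
  forces-appended τ xs ys forced rewrite serve-++ τ [] xs ys = forced

  forces-++ : ∀ τ xs ys → Forces τ xs → Forces τ (xs ++ ys)
  forces-++ τ xs ys forced = forces-appended τ xs ys λ valid →
    three-++ (serve τ [] xs) (serve τ xs ys)
      (forced (valid-prefix xs ys (serve τ [] xs) (serve τ xs ys) (serve-length τ [] xs) valid))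

  block-forces : ∀ τ xs {p r u β ys c} → BlockShape r u β ys →
    at xs p ≡ just r → at (serve τ [] xs) p ≡ just c →
    β ≡ sameColour (just c) (A τ G xs u) → Forces τ (xs ++ ys)
  block-forces τ xs (path rx xy uy) rp cp reused = forces-appended τ xs _ λ valid →
    path-three xs (serve τ [] xs) (serve-length τ [] xs) rp cp valid
      (≡ᵇ⇒≡ _ _ (subst T reused tt)) rx xy uy
  block-forces τ xs (fork rx ux) rp cp changed = forces-appended τ xs _ λ valid →
    fork-three xs (serve τ [] xs) (serve-length τ [] xs) rp cp valid
      (λ same → subst T (sym changed) (≡⇒≡ᵇ _ _ same)) rx ux

  reuses : Tape → (ℕ → Bool) → ℕ → Bool
  reuses τ f j =
    sameColour (at (serve τ [] (chain f j)) (referenceIndex j)) (A τ G (chain f j) (reference (suc j)))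

  reuses-causal : ∀ τ f g j → (∀ t → t < j → f t ≡ g t) → reuses τ f j ≡ reuses τ g j
  reuses-causal τ f g j agree =
    cong (λ xs → sameColour (at (serve τ [] xs) (referenceIndex j)) (A τ G xs (reference (suc j))))
      (chain-agree f g j agree)

  forced-at : ∀ τ f j → f j ≡ reuses τ f j → Forces τ (chain f (suc j))
  forced-at τ f j anticipated with <⇒at (serve τ [] (chain f j)) index<
    where
      index< : referenceIndex j < length (serve τ [] (chain f j))
      index< = subst (referenceIndex j <_) (sym (serve-length τ [] (chain f j)))
        (at⇒< (chain f j) (reference-at f j))
  ... | c , cp = block-forces τ (chain f j) (block-shape (f j) (side j) (column j)) (reference-at f j) cp
        (trans anticipated (cong (λ found → sameColour found (A τ G (chain f j) (reference (suc j)))) cp))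

  forced-before : ∀ τ f j m → j < m → f j ≡ reuses τ f j → Forces τ (chain f m)
  forced-before τ f j m j<m anticipated with chain-prefix f (≤⇒≤′ j<m)
  ... | ys , grown = subst (Forces τ) (sym grown) (forces-++ τ (chain f (suc j)) ys (forced-at τ f j anticipated))

Causal : {X : Set} → (X → (ℕ → Bool) → ℕ → Bool) → Set
Causal {X} decide = ∀ (x : X) f g j → (∀ t → t < j → f t ≡ g t) → decide x f j ≡ decide x g j

Anticipates : {X : Set} → (X → (ℕ → Bool) → ℕ → Bool) → ℕ → (ℕ → Bool) → X → Set
Anticipates decide m f x = Σ ℕ λ j → j < m × f j ≡ decide x f j

_◂_ : Bool → (ℕ → Bool) → ℕ → Bool
(β ◂ g) zero = β
(β ◂ g) (suc t) = g t

withBit : {X : Set} → (X → Bool) → Bool → List X → List X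
withBit b β = filter (λ x → b x Bool.≟ β)

length-withBit : ∀ {X : Set} (b : X → Bool) L →
  length (withBit b true L) + length (withBit b false L) ≡ length L
length-withBit b [] = refl
length-withBit b (x ∷ L) with b x
... | true = cong suc (length-withBit b L)
... | false = trans (+-suc (length (withBit b true L)) _) (cong suc (length-withBit b L))

minority : ∀ {X : Set} (b : X → Bool) m L → length L < 2 ^ suc m →
  Σ Bool λ β → length (withBit b (not β) L) < 2 ^ m
minority b m L short with length (withBit b true L) <? 2 ^ m
... | yes trues-short = false , trues-short
... | no trues-long = true , +-cancelˡ-< (2 ^ m) _ _ (≤-<-trans (+-monoˡ-≤ _ (≮⇒≥ trues-long)) halves)
  where
    halves : length (withBit b true L) + length (withBit b false L) < 2 ^ m + 2 ^ m
    halves = subst₂ _<_ (sym (length-withBit b L)) (cong (λ x → 2 ^ m + x) (+-identityʳ (2 ^ m))) short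

after : {X : Set} → (X → (ℕ → Bool) → ℕ → Bool) → Bool → X → (ℕ → Bool) → ℕ → Bool
after decide β x g j = decide x (β ◂ g) (suc j)

after-causal : ∀ {X : Set} {decide : X → (ℕ → Bool) → ℕ → Bool} → Causal decide → ∀ β → Causal (after decide β)
after-causal causal β x f g j agree = causal x (β ◂ f) (β ◂ g) (suc j) agree◂
  where
    agree◂ : ∀ t → t < suc j → (β ◂ f) t ≡ (β ◂ g) t
    agree◂ zero _ = refl
    agree◂ (suc t) (s≤s t<j) = agree t t<j

firstDecision : {X : Set} → (X → (ℕ → Bool) → ℕ → Bool) → X → Bool
firstDecision decide x = decide x (λ _ → false) 0

-- The first
-- bit β anticipates every element whose first decision is β; it is chosen so
-- that fewer than 2 ^ (m - 1) elements remain, which are handled recursively.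
adversary : ∀ {X : Set} (decide : X → (ℕ → Bool) → ℕ → Bool) → Causal decide →
  ∀ m (L : List X) → length L < 2 ^ m → Σ (ℕ → Bool) λ f → All (Anticipates decide m f) L
adversary decide causal zero [] _ = (λ _ → false) , []
adversary decide causal zero (_ ∷ _) (s≤s ())
adversary decide causal (suc m) L short with minority (firstDecision decide) m L short
... | β , rest-short with adversary (after decide β) (after-causal causal β) m
                            (withBit (firstDecision decide) (not β) L) rest-short
... | g , anticipated = (β ◂ g) , All.tabulate anticipate
  where
    anticipate : ∀ {x} → x ∈ L → Anticipates decide (suc m) (β ◂ g) x
    anticipate {x} x∈L with firstDecision decide x Bool.≟ β
    ... | yes first≡β = 0 , s≤s z≤n , sym (trans (causal x (β ◂ g) (λ _ → false) 0 (λ _ ())) first≡β)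
    ... | no first≢β with All.lookup anticipated (∈-filter⁺ _ x∈L (Bool.¬-not first≢β))
    ...   | j , j<m , bit = suc j , s≤s j<m , bit

bitStrings : ℕ → List (List Bool)
bitStrings zero = [] ∷ []
bitStrings (suc k) = map (true ∷_) (bitStrings k) ++ map (false ∷_) (bitStrings k)

length-bitStrings : ∀ k → length (bitStrings k) ≡ 2 ^ k
length-bitStrings zero = refl
length-bitStrings (suc k) = begin
  length (map (true ∷_) (bitStrings k) ++ map (false ∷_) (bitStrings k))
    ≡⟨ length-++ (map (true ∷_) (bitStrings k)) ⟩
  length (map (true ∷_) (bitStrings k)) + length (map (false ∷_) (bitStrings k))
    ≡⟨ cong₂ _+_ (length-map (true ∷_) (bitStrings k)) (length-map (false ∷_) (bitStrings k)) ⟩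
  length (bitStrings k) + length (bitStrings k)
    ≡⟨ cong₂ _+_ (length-bitStrings k) (trans (length-bitStrings k) (sym (+-identityʳ (2 ^ k)))) ⟩
  2 ^ suc k ∎
  where open ≡-Reasoning

prefix : ℕ → Tape → List Bool
prefix k τ = applyUpTo τ k

padTape : List Bool → Tape
padTape w i = fromMaybe false (at w i)

prefix∈bitStrings : ∀ k τ → prefix k τ ∈ bitStrings k
prefix∈bitStrings zero τ = here refl
prefix∈bitStrings (suc k) τ with τ 0
... | true = ∈-++⁺ˡ (∈-map⁺ (true ∷_) (prefix∈bitStrings k (τ ∘ suc)))
... | false = ∈-++⁺ʳ (map (true ∷_) (bitStrings k)) (∈-map⁺ (false ∷_) (prefix∈bitStrings k (τ ∘ suc)))

padTape-prefix : ∀ k τ i → i < k → padTape (prefix k τ) i ≡ τ i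
padTape-prefix (suc k) τ zero _ = refl
padTape-prefix (suc k) τ (suc i) (s≤s i<k) = padTape-prefix k (τ ∘ suc) i i<k

reads-prefix : ∀ {A Φ n k} → ReadsAtMost A Φ n k → ∀ I → size I ≡ n →
  run A (padTape (prefix k (Φ I))) I ≡ run A (Φ I) I
reads-prefix {Φ = Φ} {k = k} reads I size≡n = reads I size≡n _ (λ i i<k → padTape-prefix k (Φ I) i i<k)

-- The graph: every cell either variant of each of the first m blocks may use,
-- plus the padding cells.  It does not depend on the bits chosen.
chainGraph : ℕ → List Cell
chainGraph zero = reference 0 ∷ []
chainGraph (suc j) = chainGraph j ++ blockCells true (side j) (column j) ++ blockCells false (side j) (column j)

chain⊆chainGraph : ∀ f j → All (_∈ chainGraph j) (chain f j)
chain⊆chainGraph f zero = here refl ∷ []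
chain⊆chainGraph f (suc j) = All.++⁺ (All.map ∈-++⁺ˡ (chain⊆chainGraph f j)) (block⊆ (f j))
  where
    block⊆ : ∀ β → All (_∈ chainGraph (suc j)) (blockCells β (side j) (column j))
    block⊆ true = All.tabulate (∈-++⁺ʳ (chainGraph j) ∘ ∈-++⁺ˡ)
    block⊆ false = All.tabulate (∈-++⁺ʳ (chainGraph j) ∘ ∈-++⁺ʳ (blockCells true (side j) (column j)))

paddingCells : ℕ → List Cell
paddingCells e = map proj₁ (padding e 0)

hardGraph : ℕ → ℕ → List Cell
hardGraph m e = chainGraph m ++ paddingCells e

hardInstance : ℕ → ℕ → (ℕ → Bool) → Instance
hardInstance m e f = mkInstance (hardGraph m e) (chain f m ++ paddingCells e)
  (All.++⁺ (All.map ∈-++⁺ˡ (chain⊆chainGraph f m)) (All.tabulate (∈-++⁺ʳ (chainGraph m))))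

size-hardInstance : ∀ m e f → size (hardInstance m e f) ≡ suc (m * 3) + e
size-hardInstance m e f = trans (length-++ (chain f m))
  (cong₂ _+_ (length-chain f m) (trans (length-map proj₁ (padding e 0)) (length-padding e 0)))
  where
    length-padding : ∀ e a → length (padding e a) ≡ e
    length-padding zero a = refl
    length-padding (suc e) a = cong suc (length-padding e (2 + a))

needs-two : ∀ reqs {i j v w} → i < j → at reqs i ≡ just v → at reqs j ≡ just w → Adj v w →
  ∀ c → (Σ (List (Fin c)) λ cols → ValidColouring reqs cols) → 2 ≤ c
needs-two reqs {i} i<j vi wj adj zero (cols , len , _) with <⇒at cols (subst (i <_) (sym len) (at⇒< reqs vi))
... | () , _
needs-two reqs {i} {j} i<j vi wj adj (suc zero) (cols , len , valid)
  with <⇒at cols (subst (i <_) (sym len) (at⇒< reqs vi)) | <⇒at cols (subst (j <_) (sym len) (at⇒< reqs wj))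
... | zero , ci | zero , cj = ⊥-elim (valid i j _ _ _ _ i<j vi wj ci cj (inj₂ adj) refl)
needs-two reqs i<j vi wj adj (suc (suc c)) _ = s≤s (s≤s z≤n)

shape-second : ∀ {r u β ys} → BlockShape r u β ys → Σ Cell λ x → at ys 1 ≡ just x × Adj r x
shape-second (path rx _ _) = _ , refl , rx
shape-second (fork rx _) = _ , refl , rx

opt-hardInstance : ∀ k e f → IsOpt (hardInstance (suc k) e f) 2
opt-hardInstance k e f = (map proj₂ colouring , subst (λ reqs → ValidColouring reqs (map proj₂ colouring)) cells valid) ,
  needs-two (requests (hardInstance (suc k) e f)) (s≤s z≤n) first third adj
  where
    colouring : List (Cell × Col)
    colouring = offlineColouring f (suc k) e
    valid : ValidColouring (map proj₁ colouring) (map proj₂ colouring)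
    valid = compatible⇒valid colouring (offline-compatible f (suc k) e)
    cells : map proj₁ colouring ≡ chain f (suc k) ++ paddingCells e
    cells = trans (map-++ proj₁ (colouredChain f (suc k)) (padding e 0)) (cong (_++ paddingCells e) (cells-colouredChain f (suc k)))
    second : Σ Cell λ x → at (blockCells (f 0) below 2) 1 ≡ just x × Adj (reference 0) x
    second = shape-second (block-shape (f 0) below 2)
    early : ∀ {i v} → at (chain f 1) i ≡ just v → at (chain f (suc k) ++ paddingCells e) i ≡ just v
    early {i} vi with chain-prefix f {1} {suc k} (≤⇒≤′ (s≤s z≤n))
    ... | ys , grown rewrite grown =
      at-++ˡ (chain f 1 ++ ys) (paddingCells e) {i} (at-++ˡ (chain f 1) ys {i} vi)
    first : at (chain f (suc k) ++ paddingCells e) 0 ≡ just (reference 0)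
    first = early {0} refl
    third : at (chain f (suc k) ++ paddingCells e) 2 ≡ just (proj₁ second)
    third = early {2} (proj₁ (proj₂ second))
    adj : Adj (reference 0) (proj₁ second)
    adj = proj₂ (proj₂ second)

hard-instance : ∀ A k e → Σ (ℕ → Bool) λ f → ∀ τ →
  ValidColouring (requests (hardInstance (suc k) e f)) (run A (padTape (prefix k τ)) (hardInstance (suc k) e f)) →
  ThreeColours (run A (padTape (prefix k τ)) (hardInstance (suc k) e f))
hard-instance A k e = f , forced
  where
    open Serve A (hardGraph (suc k) e)
    decide : List Bool → (ℕ → Bool) → ℕ → Bool
    decide w = reuses (padTape w)
    few : length (bitStrings k) < 2 ^ suc k
    few = subst (_< 2 ^ suc k) (sym (length-bitStrings k)) (^-monoʳ-< 2 (s≤s (s≤s z≤n)) (n<1+n k))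
    anticipating : Σ (ℕ → Bool) λ f → All (Anticipates decide (suc k) f) (bitStrings k)
    anticipating = adversary decide (λ w → reuses-causal (padTape w)) (suc k) (bitStrings k) few
    f : ℕ → Bool
    f = proj₁ anticipating
    forced : ∀ τ → Forces (padTape (prefix k τ)) (chain f (suc k) ++ paddingCells e)
    forced τ with All.lookup (proj₂ anticipating) (prefix∈bitStrings k τ)
    ... | j , j<m , bit = forces-++ _ (chain f (suc k)) (paddingCells e) (forced-before _ f j (suc k) j<m bit)

blocks-fit : ∀ n k → k < (n ∸ 1) / 3 → suc (suc k * 3) ≤ n
blocks-fit (suc n) k k<n/3 = s≤s (≤-trans (*-monoˡ-≤ 3 k<n/3) (m/n*n≤m n 3))

ratio-violated : ∀ p q {used} → 2 * p < 3 * q → 3 ≤ used → q * used ≤ p * 2 → ⊥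
ratio-violated p q {used} ratio three-used competitive = <-irrefl refl (<-≤-trans ratio (begin
  3 * q    ≡⟨ *-comm 3 q ⟩
  q * 3    ≤⟨ *-monoʳ-≤ q three-used ⟩
  q * used ≤⟨ competitive ⟩
  p * 2    ≡⟨ *-comm p 2 ⟩
  2 * p    ∎))
  where open ≤-Reasoning

theorem6 : (A : Algorithm) (Φ : Instance → Tape) →
    (∀ I → ValidColouring (requests I) (run A (Φ I) I)) →
    (p q : ℕ) → 2 * p < 3 * q →
    (∀ I k → IsOpt I k → q * coloursUsed (run A (Φ I) I) ≤ p * k) →
    ∀ n k → k < (n ∸ 1) / 3 → ¬ ReadsAtMost A Φ n k
theorem6 A Φ valid p q ratio competitive n k k<n/3 reads =
  ratio-violated p q ratio (three⇒coloursUsed _ third-colour) (competitive I 2 (opt-hardInstance k e f))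
  where
    e : ℕ
    e = n ∸ suc (suc k * 3)
    f : ℕ → Bool
    f = proj₁ (hard-instance A k e)
    I : Instance
    I = hardInstance (suc k) e f
    same-run : run A (padTape (prefix k (Φ I))) I ≡ run A (Φ I) I
    same-run = reads-prefix reads I (trans (size-hardInstance (suc k) e f) (m+[n∸m]≡n (blocks-fit n k k<n/3)))
    third-colour : ThreeColours (run A (Φ I) I)
    third-colour = subst ThreeColours same-run
      (proj₂ (hard-instance A k e) (Φ I) (subst (ValidColouring (requests I)) (sym same-run) (valid I)))
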